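{- For $n\ge 4$, the cycle $C_n$ on $n$ vertices is $\alpha^{++}$-stable if and only if $n$ is odd.
   Context: $\alpha(G)$ is the maximum size of a stable set. For $e\in E(\overline{G})$ (a pair of distinct non-adjacent vertices), $G+e$ denotes $G$ with $e$ added. $G$ is $\alpha^{++}$-stable if $\alpha(G+e_1+e_2)=\alpha(G)$ for any $e_1,e_2\in E(\overline{G})$ (not necessarily distinct). -}

module Defs where

open import Data.Nat using (ℕ; zero; suc; _≤_)
open import Data.Nat.DivMod using (_%_)
open import Data.Fin using (Fin; toℕ)
open import Data.Fin.Subset using (Subset; _∈_; ∣_∣)
open import Data.Product using (Σ; _×_; _,_; proj₁)
open import Data.Sum using (_⊎_)
open import Relation.Nullary using (¬_)
open import Relation.Binary.PropositionalEquality using (_≡_)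

-- The graphs used below (cycles and edge additions to
-- them) are symmetric and loopless by construction.
Graph : ℕ → Set₁
Graph n = Fin n → Fin n → Set

IsStable : ∀ {n} → Graph n → Subset n → Set
IsStable G S = ∀ u v → u ∈ S → v ∈ S → ¬ G u v

IsAlpha : ∀ {n} → Graph n → ℕ → Set
IsAlpha {n} G k =
  Σ (Subset n) (λ S → IsStable G S × ∣ S ∣ ≡ k)
  × (∀ S → IsStable G S → ∣ S ∣ ≤ k)

NonEdge : ∀ {n} → Graph n → Fin n → Fin n → Set
NonEdge G u v = ¬ (u ≡ v) × ¬ G u v

addEdge : ∀ {n} → Graph n → Fin n → Fin n → Graph n
addEdge G u v x y = G x y ⊎ ((x ≡ u × y ≡ v) ⊎ (x ≡ v × y ≡ u))

SameAlpha : ∀ {n} → Graph n → Graph n → Set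
SameAlpha G H = ∀ k → IsAlpha G k → IsAlpha H k

AlphaPPStable : ∀ {n} → Graph n → Set
AlphaPPStable G =
  ∀ u₁ v₁ u₂ v₂ → NonEdge G u₁ v₁ → NonEdge G u₂ v₂ →
  SameAlpha G (addEdge (addEdge G u₁ v₁) u₂ v₂)

Cycle : (n : ℕ) → Graph n
Cycle zero ()
Cycle (suc m) i j =
  (toℕ j ≡ suc (toℕ i) % suc m) ⊎ (toℕ i ≡ suc (toℕ j) % suc m)

{-# OPTIONS --safe #-}
-- A stable set of a path on m vertices has at most ⌈m/2⌉ elements, and at most
-- ⌊m/2⌋ if it misses an end vertex; hence α(C_n) = ⌊n/2⌋, attained by the odd
-- vertices.  For odd n, any two vertices a and b are missed by a maximum stable
-- set: the alternating set whose only two consecutive non-members are c and c+1,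
-- with c ∈ {a, b} chosen by the parity of b − a.  It stays stable when any edges
-- at a and b are added, so α does not change.  For even n, add the chords {0,2}
-- and {1,3}: a stable set then meets {0,1,2,3} in at most one vertex or in {0,3},
-- and the path bound on the remaining vertices leaves at most n/2 − 1 of them.
module Submission where

open import Defs
open import Data.Nat using (ℕ; zero; suc; _+_; _≤_; _<_; z≤n; s≤s; ⌊_/2⌋; ⌈_/2⌉)
open import Data.Nat.Properties using (≤-refl; ≤-trans; ≤-antisym; <-irrefl; n≤1+n; ⌈n/2⌉-mono; m≤n⇒m<n∨m≡n)
open import Data.Nat.DivMod using (_%_; m<n⇒m%n≡m; n%n≡0)
open import Data.Bool using (Bool; true; false; not)
open import Data.Bool.Properties using (not-injective)
open import Data.Fin using (Fin; zero; suc; toℕ; #_)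
open import Data.Fin.Properties using (toℕ<n; toℕ≤pred[n])
open import Data.Fin.Subset using (Subset; _∈_; _∉_; ∣_∣)
open import Data.Vec using ([]; _∷_; tabulate; here; there)
open import Data.Vec.Properties using ([]=⇒lookup; lookup∘tabulate)
open import Data.Product using (∃-syntax; _×_; _,_; proj₂)
open import Data.Sum using (_⊎_; inj₁; inj₂; [_,_]′)
import Data.Sum as Sum
open import Data.Empty using (⊥; ⊥-elim)
open import Function using (_∘_)
open import Function.Bundles using (_⇔_; mk⇔; Equivalence)
open import Relation.Nullary using (¬_; contradiction)
open import Relation.Binary.Core using (_⇒_)
open import Relation.Binary.PropositionalEquality using (_≡_; refl; sym; trans; cong; subst)

private
  variable
    n : ℕ
    G H : Graph n
    S : Subset n

stable-antimono : G ⇒ H → IsStable H S → IsStable G S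
stable-antimono G⇒H st u v u∈ v∈ = st u v u∈ v∈ ∘ G⇒H

addEdge-stable : ∀ {u v} → IsStable G S → u ∉ S → IsStable (addEdge G u v) S
addEdge-stable st u∉ x y x∈ y∈ (inj₁ e)               = st x y x∈ y∈ e
addEdge-stable st u∉ x y x∈ y∈ (inj₂ (inj₁ (refl , _))) = u∉ x∈
addEdge-stable st u∉ x y x∈ y∈ (inj₂ (inj₂ (_ , refl))) = u∉ y∈

alpha-unique : ∀ {k l} → IsAlpha G k → IsAlpha G l → k ≡ l
alpha-unique ((S , stS , refl) , maxS) ((T , stT , refl) , maxT) =
  ≤-antisym (maxT S stS) (maxS T stT)

sameAlpha-by-witness : ∀ {k} → G ⇒ H → IsAlpha G k → IsStable H S → ∣ S ∣ ≡ k →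
                       SameAlpha G H
sameAlpha-by-witness {S = S} G⇒H αk stS refl l αl =
  (S , stS , alpha-unique αk αl) , λ T stT → proj₂ αl T (stable-antimono G⇒H stT)

¬sameAlpha-by-bound : ∀ {k} → IsAlpha G k → (∀ S → IsStable H S → ∣ S ∣ < k) →
                      ¬ SameAlpha G H
¬sameAlpha-by-bound αk small same with same _ αk
... | (S , stS , refl) , _ = <-irrefl refl (small S stS)

Path : (n : ℕ) → Graph n
Path n i j = suc (toℕ i) ≡ toℕ j ⊎ suc (toℕ j) ≡ toℕ i

path⇒cycle : Path n ⇒ Cycle n
path⇒cycle {suc m} {u} {v} = Sum.map (arc u v) (arc v u)
  where
  arc : ∀ u v → suc (toℕ u) ≡ toℕ v → toℕ v ≡ suc (toℕ u) % suc m
  arc u v e = sym (trans (m<n⇒m%n≡m (subst (_< suc m) (sym e) (toℕ<n v))) e)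

cycle-wrap : ∀ {m} (i : Fin (suc m)) → suc (toℕ i) ≡ suc m → Cycle (suc m) i zero
cycle-wrap {m} i e = inj₁ (sym (trans (cong (_% suc m) e) (n%n≡0 (suc m))))

tail-stable : ∀ {x} → IsStable (Path (suc n)) (x ∷ S) → IsStable (Path n) S
tail-stable st i j i∈ j∈ e =
  st (suc i) (suc j) (there i∈) (there j∈) (Sum.map (cong suc) (cong suc) e)

path-bound : (S : Subset n) → IsStable (Path n) S → ∣ S ∣ ≤ ⌈ n /2⌉
path-bound []                 _  = z≤n
path-bound (false ∷ S)        st = ≤-trans (path-bound S (tail-stable st)) (⌈n/2⌉-mono (n≤1+n _))
path-bound (true ∷ [])        _  = ≤-refl
path-bound (true ∷ true ∷ _)  st = ⊥-elim (st zero (suc zero) here (there here) (inj₁ refl))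
path-bound (true ∷ false ∷ S) st = s≤s (path-bound S (tail-stable (tail-stable st)))

path-bound-∉last : (S : Subset n) → IsStable (Path n) S →
                   (∀ i → suc (toℕ i) ≡ n → i ∉ S) → ∣ S ∣ ≤ ⌊ n /2⌋
path-bound-∉last []                 _  _     = z≤n
path-bound-∉last (false ∷ S)        st _     = path-bound S (tail-stable st)
path-bound-∉last (true ∷ [])        _  last∉ = ⊥-elim (last∉ zero refl here)
path-bound-∉last (true ∷ true ∷ _)  st _     = ⊥-elim (st zero (suc zero) here (there here) (inj₁ refl))
path-bound-∉last (true ∷ false ∷ S) st last∉ =
  s≤s (path-bound-∉last S (tail-stable (tail-stable st))
         (λ i e → last∉ (suc (suc i)) (cong (2 +_) e) ∘ there ∘ there))

cycle-bound : (S : Subset n) → IsStable (Cycle n) S → ∣ S ∣ ≤ ⌊ n /2⌋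
cycle-bound []          _  = z≤n
cycle-bound (false ∷ S) st = path-bound S (tail-stable (stable-antimono path⇒cycle st))
cycle-bound (true ∷ S)  st = path-bound-∉last (true ∷ S) (stable-antimono path⇒cycle st)
                               (λ i e i∈ → st i zero i∈ here (cycle-wrap i e))

CycleWithChords : (m : ℕ) → Graph (4 + m)
CycleWithChords m = addEdge (addEdge (Cycle (4 + m)) (# 0) (# 2)) (# 1) (# 3)

chords-bound : ∀ m (S : Subset (4 + m)) → IsStable (CycleWithChords m) S → ∣ S ∣ ≤ suc ⌈ m /2⌉
chords-bound m S st = cases S st (stable-antimono (inj₁ ∘ inj₁ ∘ path⇒cycle) st)
  where
  cases : ∀ S → IsStable (CycleWithChords m) S → IsStable (Path (4 + m)) S → ∣ S ∣ ≤ suc ⌈ m /2⌉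
  cases (false ∷ false ∷ S) _ pst = path-bound S (tail-stable (tail-stable pst))
  cases (false ∷ true ∷ true ∷ _) _ pst =
    ⊥-elim (pst (# 1) (# 2) (there here) (there (there here)) (inj₁ refl))
  cases (false ∷ true ∷ false ∷ true ∷ _) st _ =
    ⊥-elim (st (# 1) (# 3) (there here) (there (there (there here))) (inj₂ (inj₁ (refl , refl))))
  cases (false ∷ true ∷ false ∷ false ∷ S) _ pst =
    s≤s (path-bound S (tail-stable (tail-stable (tail-stable (tail-stable pst)))))
  cases (true ∷ true ∷ _) _ pst =
    ⊥-elim (pst (# 0) (# 1) here (there here) (inj₁ refl))
  cases (true ∷ false ∷ true ∷ _) st _ =
    ⊥-elim (st (# 0) (# 2) here (there (there here)) (inj₁ (inj₂ (inj₁ (refl , refl)))))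
  cases (true ∷ false ∷ false ∷ S) st pst =
    s≤s (path-bound-∉last S (tail-stable (tail-stable (tail-stable pst)))
           (λ i e i∈ → st (suc (suc (suc i))) zero (there (there (there i∈))) here
                          (inj₁ (inj₁ (cycle-wrap _ (cong (3 +_) e))))))

isOdd : ℕ → Bool
isOdd zero          = false
isOdd (suc zero)    = true
isOdd (suc (suc n)) = isOdd n

isOdd-suc : ∀ n → isOdd (suc n) ≡ not (isOdd n)
isOdd-suc zero          = refl
isOdd-suc (suc zero)    = refl
isOdd-suc (suc (suc n)) = isOdd-suc n

isOdd-pred : ∀ n → isOdd (suc n) ≡ true → isOdd n ≡ false
isOdd-pred n odd = not-injective (trans (sym (isOdd-suc n)) odd)

isOdd⇔%2≡1 : ∀ n → isOdd n ≡ true ⇔ n % 2 ≡ 1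
isOdd⇔%2≡1 zero          = mk⇔ (λ ()) (λ ())
isOdd⇔%2≡1 (suc zero)    = mk⇔ (λ _ → refl) (λ _ → refl)
isOdd⇔%2≡1 (suc (suc n)) = isOdd⇔%2≡1 n

even⇒⌈n/2⌉≡⌊n/2⌋ : ∀ n → isOdd n ≡ false → ⌈ n /2⌉ ≡ ⌊ n /2⌋
even⇒⌈n/2⌉≡⌊n/2⌋ zero          _    = refl
even⇒⌈n/2⌉≡⌊n/2⌋ (suc (suc n)) even = cong suc (even⇒⌈n/2⌉≡⌊n/2⌋ n even)

subsetOf : (ℕ → Bool) → (n : ℕ) → Subset n
subsetOf g n = tabulate (g ∘ toℕ)

∈-subsetOf : ∀ g {i : Fin n} → i ∈ subsetOf g n → g (toℕ i) ≡ true
∈-subsetOf g {i} i∈ = trans (sym (lookup∘tabulate (g ∘ toℕ) i)) ([]=⇒lookup i∈)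

∉-subsetOf : ∀ g {i : Fin n} → g (toℕ i) ≡ false → i ∉ subsetOf g n
∉-subsetOf g gi≡false i∈ with () ← trans (sym gi≡false) (∈-subsetOf g i∈)

NoConsecutive : (ℕ → Bool) → Set
NoConsecutive g = ∀ x → g x ≡ true → g (suc x) ≡ false

cycle-step : ∀ {m} (u v : Fin (suc m)) → toℕ v ≡ suc (toℕ u) % suc m →
             suc (toℕ u) ≡ toℕ v ⊎ (toℕ u ≡ m × toℕ v ≡ 0)
cycle-step {m} u v arc with m≤n⇒m<n∨m≡n (toℕ≤pred[n] u)
... | inj₁ u<m = inj₁ (sym (trans arc (m<n⇒m%n≡m (s≤s u<m))))
... | inj₂ u≡m = inj₂ (u≡m , trans arc (trans (cong (λ x → suc x % suc m) u≡m) (n%n≡0 (suc m))))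

subsetOf-stable : ∀ {g} m → NoConsecutive g → (g 0 ≡ true → g m ≡ false) →
                  IsStable (Cycle (suc m)) (subsetOf g (suc m))
subsetOf-stable {g} m noCons wrap u v u∈ v∈ = [ no-arc u v u∈ v∈ , no-arc v u v∈ u∈ ]′
  where
  no-arc : ∀ u v → u ∈ subsetOf g (suc m) → v ∈ subsetOf g (suc m) →
           toℕ v ≡ suc (toℕ u) % suc m → ⊥
  no-arc u v u∈ v∈ arc with cycle-step u v arc
  ... | inj₁ u+1≡v = ∉-subsetOf g (subst (λ x → g x ≡ false) u+1≡v (noCons _ (∈-subsetOf g u∈))) v∈
  ... | inj₂ (u≡m , v≡0) =
    ∉-subsetOf g (subst (λ x → g x ≡ false) (sym u≡m)
                    (wrap (subst (λ x → g x ≡ true) v≡0 (∈-subsetOf g v∈)))) u∈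

isOdd-noConsecutive : NoConsecutive isOdd
isOdd-noConsecutive x odd = trans (isOdd-suc x) (cong not odd)

∣odds∣ : ∀ n → ∣ subsetOf isOdd n ∣ ≡ ⌊ n /2⌋
∣odds∣ zero          = refl
∣odds∣ (suc zero)    = refl
∣odds∣ (suc (suc n)) = cong suc (∣odds∣ n)

odds-stable : ∀ n → IsStable (Cycle n) (subsetOf isOdd n)
odds-stable zero    ()
odds-stable (suc m) = subsetOf-stable m isOdd-noConsecutive (λ ())

cycle-alpha : ∀ n → IsAlpha (Cycle n) ⌊ n /2⌋
cycle-alpha n = (subsetOf isOdd n , odds-stable n , ∣odds∣ n) , cycle-bound

-- gap c = {x < c : c ∸ x odd} ∪ {x > c : x ∸ c even}.
gap : ℕ → ℕ → Bool
gap c       zero    = isOdd c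
gap zero    (suc x) = isOdd x
gap (suc c) (suc x) = gap c x

gap-diag : ∀ c → gap c c ≡ false
gap-diag zero    = refl
gap-diag (suc c) = gap-diag c

gap-noConsecutive : ∀ c → NoConsecutive (gap c)
gap-noConsecutive zero    zero    ()
gap-noConsecutive zero    (suc x) = isOdd-noConsecutive x
gap-noConsecutive (suc c) zero    = isOdd-pred c
gap-noConsecutive (suc c) (suc x) = gap-noConsecutive c x

gap-last : ∀ c m → isOdd m ≡ false → c ≤ m → isOdd c ≡ true → gap c m ≡ false
gap-last (suc zero)    (suc zero)    ()   _                 _
gap-last (suc zero)    (suc (suc m)) even _                 _   = even
gap-last (suc (suc c)) (suc (suc m)) even (s≤s (s≤s c≤m)) odd = gap-last c m even c≤m odd

gap-stable : ∀ {c} n → isOdd n ≡ true → c < n → IsStable (Cycle n) (subsetOf (gap c) n)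
gap-stable {c} (suc m) odd (s≤s c≤m) =
  subsetOf-stable m (gap-noConsecutive c)
    (gap-last c m (isOdd-pred m odd) c≤m)

∣isOdd∷isOdd∷S∣ : ∀ c (S : Subset n) → ∣ isOdd c ∷ isOdd (suc c) ∷ S ∣ ≡ suc ∣ S ∣
∣isOdd∷isOdd∷S∣ zero          _ = refl
∣isOdd∷isOdd∷S∣ (suc zero)    _ = refl
∣isOdd∷isOdd∷S∣ (suc (suc c)) S = ∣isOdd∷isOdd∷S∣ c S

∣gap∣ : ∀ c n → c < n → isOdd n ≡ true → ∣ subsetOf (gap c) n ∣ ≡ ⌊ n /2⌋
∣gap∣ zero          (suc zero)          _                 _   = refl
∣gap∣ zero          (suc (suc (suc n))) _                 odd = cong suc (∣gap∣ zero (suc n) (s≤s z≤n) odd)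
∣gap∣ (suc zero)    (suc zero)          (s≤s ())          _
∣gap∣ (suc zero)    (suc (suc n))       _                 _   = cong suc (∣odds∣ n)
∣gap∣ (suc (suc c)) (suc (suc n))       (s≤s (s≤s c<n)) odd =
  trans (∣isOdd∷isOdd∷S∣ c (subsetOf (gap c) n)) (cong suc (∣gap∣ c n c<n odd))

gap-avoiding : ∀ a b → ∃[ c ] (c ≡ a ⊎ c ≡ b) × gap c a ≡ false × gap c b ≡ false
gap-avoiding zero    zero = zero , inj₁ refl , refl , refl
gap-avoiding zero    (suc b) with isOdd b in odd
... | true  = suc b , inj₂ refl , isOdd-noConsecutive b odd , gap-diag b
... | false = zero , inj₁ refl , refl , odd
gap-avoiding (suc a) zero with gap-avoiding zero (suc a)
... | c , c≡ , avoids₀ , avoidsa = c , Sum.swap c≡ , avoidsa , avoids₀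
gap-avoiding (suc a) (suc b) with gap-avoiding a b
... | c , c≡ , avoidsa , avoidsb = suc c , Sum.map (cong suc) (cong suc) c≡ , avoidsa , avoidsb

odd-cycle-stable : ∀ n → isOdd n ≡ true → AlphaPPStable (Cycle n)
odd-cycle-stable n odd u₁ v₁ u₂ v₂ _ _ with gap-avoiding (toℕ u₁) (toℕ u₂)
... | c , c≡u , u₁∉ , u₂∉ =
  sameAlpha-by-witness (inj₁ ∘ inj₁) (cycle-alpha n)
    (addEdge-stable (addEdge-stable (gap-stable n odd c<n) (∉-subsetOf (gap c) u₁∉))
                    (∉-subsetOf (gap c) u₂∉))
    (∣gap∣ c n c<n odd)
  where
  c<n : c < n
  c<n = [ (λ { refl → toℕ<n u₁ }) , (λ { refl → toℕ<n u₂ }) ]′ c≡u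

even-cycle-unstable : ∀ n → 4 ≤ n → isOdd n ≡ false → ¬ AlphaPPStable (Cycle n)
even-cycle-unstable (suc (suc (suc (suc m)))) (s≤s (s≤s (s≤s (s≤s _)))) even stable =
  ¬sameAlpha-by-bound (cycle-alpha (4 + m)) smaller
    (stable (# 0) (# 2) (# 1) (# 3) ((λ ()) , [ (λ ()) , (λ ()) ]′) ((λ ()) , [ (λ ()) , 1≢4%[4+m] m ]′))
  where
  smaller : ∀ S → IsStable (CycleWithChords m) S → ∣ S ∣ < ⌊ 4 + m /2⌋
  smaller S st = s≤s (subst (λ h → ∣ S ∣ ≤ suc h) (even⇒⌈n/2⌉≡⌊n/2⌋ m even) (chords-bound m S st))
  1≢4%[4+m] : ∀ m → ¬ 1 ≡ 4 % (4 + m)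
  1≢4%[4+m] zero    ()
  1≢4%[4+m] (suc _) ()

corollary3 : (n : ℕ) → 4 ≤ n → (AlphaPPStable (Cycle n) ⇔ (n % 2 ≡ 1))
corollary3 n 4≤n with isOdd n in parity
... | true  = mk⇔ (λ _ → Equivalence.to (isOdd⇔%2≡1 n) parity) (λ _ → odd-cycle-stable n parity)
... | false = mk⇔ (⊥-elim ∘ even-cycle-unstable n 4≤n parity)
                  (λ n%2≡1 → contradiction (trans (sym (Equivalence.from (isOdd⇔%2≡1 n) n%2≡1)) parity) λ ())
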